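{- Let $V$ be a finite set and let $S_1,\ldots,S_m$ be pairwise disjoint subsets of $V$. Then the collection $\{V;S_1,\ldots,S_m\}$ is invertible if and only if $|S_i|\leq |V|/2$ for every $i=1,\ldots,m$.
   Context: A collection $\{V;S_1,\ldots,S_m\}$ of subsets of $V$ is called invertible if there is a permutation $\pi$ of $V$ such that $\pi(S_i)\subseteq V\setminus S_i$ for every $i=1,\ldots,m$. -}

module Defs where

open import Data.Nat using (ℕ)
open import Data.Fin using (Fin)
open import Data.Fin.Subset using (Subset; _∈_; _∉_)
open import Data.Fin.Permutation using (Permutation′; _⟨$⟩ʳ_)
open import Data.Product using (Σ)
open import Relation.Binary.PropositionalEquality using (_≡_)
open import Relation.Nullary using (¬_)

MapsOutside : ∀ {n} → Permutation′ n → Subset n → Set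
MapsOutside π T = ∀ x → x ∈ T → (π ⟨$⟩ʳ x) ∉ T

Invertible : ∀ {n m} → (Fin m → Subset n) → Set
Invertible {n} S = Σ (Permutation′ n) λ π → ∀ i → MapsOutside π (S i)

PairwiseDisjoint : ∀ {n m} → (Fin m → Subset n) → Set
PairwiseDisjoint S = ∀ i j → ¬ i ≡ j → ∀ x → x ∈ S i → x ∉ S j

{-# OPTIONS --safe #-}
-- Necessity: a permutation mapping S into V ∖ S injects S into its complement, so |S| ≤ |V| − |S|.
-- Sufficiency: number V as 0, …, n − 1 so that every Sᵢ occupies consecutive positions (sort by the
-- index of the set containing an element) and rotate cyclically by ⌊n/2⌋. Every position moves by at
-- least ⌊n/2⌋ ≥ |Sᵢ|, whereas two positions inside the block of Sᵢ differ by less than |Sᵢ|.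
module Submission where

open import Defs
open import Algebra.Properties.CommutativeMonoid.Sum as Sum using ()
open import Data.Bool using (Bool; true; false)
open import Data.Fin as Fin using (Fin; zero; suc; toℕ; fromℕ<; punchOut; combine)
import Data.Fin.Properties as Finₚ
open import Data.Fin.Permutation using (Permutation′; permutation; _⟨$⟩ʳ_; _∘ₚ_; flip; inverseʳ)
open import Data.Fin.Subset using (Subset; ∣_∣; _∈_; _∉_; _∪_; _⊂_; inside; outside)
open import Data.Fin.Subset.Properties
  using (_∈?_; ∣p∣≤n; ∣p∣≤∣x∷p∣; ∣∁p∣≡n∸∣p∣; x∉p⇒x∈∁p; p⊂q⇒∣p∣<∣q∣; ∈⊤; ⊆⊤; ∣⊤∣≡n; x∈p∪q⁺)
open import Data.Nat using (ℕ; zero; suc; _+_; _*_; _∸_; _⊓_; _≤_; _<_; _<?_; _≤?_; ∣_-_∣; ⌊_/2⌋; ⌈_/2⌉; z≤n; s≤s)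
open import Data.Nat.Properties
open import Data.Product using (_×_; _,_; proj₁; proj₂)
open import Data.Sum using (inj₁; inj₂)
open import Data.Vec using ([]; _∷_; lookup; tabulate)
open import Data.Vec.Properties using (lookup∘tabulate; []=⇒lookup; lookup⇒[]=)
open import Function using (_∘_)
open import Function.Definitions using (Injective; StrictlySurjective)
open import Relation.Binary.Definitions using (tri<; tri≈; tri>)
open import Relation.Binary.PropositionalEquality
open import Relation.Nullary using (yes; no; does; contradiction)
open import Relation.Nullary.Decidable using (dec-true)
open import Relation.Unary using (Pred; Decidable)

open Sum +-0-commutativeMonoid using (sum; sum-permute)

private
  variable
    n : ℕ

indicator : Bool → ℕ
indicator true = 1
indicator false = 0

∣p∣≡∑indicator : (p : Subset n) → ∣ p ∣ ≡ sum (indicator ∘ lookup p)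
∣p∣≡∑indicator [] = refl
∣p∣≡∑indicator (true ∷ p) = cong suc (∣p∣≡∑indicator p)
∣p∣≡∑indicator (false ∷ p) = ∣p∣≡∑indicator p

sum-mono-≤ : {f g : Fin n → ℕ} → (∀ x → f x ≤ g x) → sum f ≤ sum g
sum-mono-≤ {zero} f≤g = z≤n
sum-mono-≤ {suc n} f≤g = +-mono-≤ (f≤g zero) (sum-mono-≤ (f≤g ∘ suc))

permutation-⊆⇒∣p∣≤∣q∣ : (π : Permutation′ n) {p q : Subset n} →
                        (∀ {x} → x ∈ p → π ⟨$⟩ʳ x ∈ q) → ∣ p ∣ ≤ ∣ q ∣
permutation-⊆⇒∣p∣≤∣q∣ π {p} {q} πp⊆q = begin
  ∣ p ∣                                ≡⟨ ∣p∣≡∑indicator p ⟩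
  sum (indicator ∘ lookup p)           ≤⟨ sum-mono-≤ pointwise ⟩
  sum (indicator ∘ lookup q ∘ (π ⟨$⟩ʳ_)) ≡⟨ sum-permute (indicator ∘ lookup q) π ⟨
  sum (indicator ∘ lookup q)           ≡⟨ ∣p∣≡∑indicator q ⟨
  ∣ q ∣                                ∎
  where
  open ≤-Reasoning
  pointwise : ∀ x → indicator (lookup p x) ≤ indicator (lookup q (π ⟨$⟩ʳ x))
  pointwise x with lookup p x in x∈p
  ... | false = z≤n
  ... | true rewrite []=⇒lookup (πp⊆q (lookup⇒[]= x p x∈p)) = ≤-refl

mapsOutside⇒2*∣p∣≤n : (π : Permutation′ n) (p : Subset n) → MapsOutside π p →
                      2 * ∣ p ∣ ≤ n
mapsOutside⇒2*∣p∣≤n {n} π p π-avoids-p = begin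
  2 * ∣ p ∣     ≡⟨ cong (∣ p ∣ +_) (+-identityʳ ∣ p ∣) ⟩
  ∣ p ∣ + ∣ p ∣ ≤⟨ m≤o∸n⇒m+n≤o ∣ p ∣ (∣p∣≤n p) ∣p∣≤n∸∣p∣ ⟩
  n             ∎
  where
  open ≤-Reasoning
  ∣p∣≤n∸∣p∣ : ∣ p ∣ ≤ n ∸ ∣ p ∣
  ∣p∣≤n∸∣p∣ = subst (∣ p ∣ ≤_) (∣∁p∣≡n∸∣p∣ p)
    (permutation-⊆⇒∣p∣≤∣q∣ π (x∉p⇒x∈∁p ∘ π-avoids-p _))

module _ {ℓ} {P : Pred (Fin n) ℓ} (P? : Decidable P) where

  select : Subset n
  select = tabulate (does ∘ P?)

  ∈-select⁺ : ∀ {x} → P x → x ∈ select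
  ∈-select⁺ {x} px =
    lookup⇒[]= x select (trans (lookup∘tabulate (does ∘ P?) x) (dec-true (P? x) px))

  ∈-select⁻ : ∀ {x} → x ∈ select → P x
  ∈-select⁻ {x} x∈select
    with P? x | trans (sym (lookup∘tabulate (does ∘ P?) x)) ([]=⇒lookup x∈select)
  ... | yes px | _ = px
  ... | no _   | ()

∣p∪q∣≤∣p∣+∣q∣ : (p q : Subset n) → ∣ p ∪ q ∣ ≤ ∣ p ∣ + ∣ q ∣
∣p∪q∣≤∣p∣+∣q∣ [] [] = z≤n
∣p∪q∣≤∣p∣+∣q∣ (inside ∷ p) (x ∷ q) =
  s≤s (≤-trans (∣p∪q∣≤∣p∣+∣q∣ p q) (+-monoʳ-≤ ∣ p ∣ (∣p∣≤∣x∷p∣ x q)))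
∣p∪q∣≤∣p∣+∣q∣ (outside ∷ p) (inside ∷ q) =
  subst (suc ∣ p ∪ q ∣ ≤_) (sym (+-suc ∣ p ∣ ∣ q ∣)) (s≤s (∣p∪q∣≤∣p∣+∣q∣ p q))
∣p∪q∣≤∣p∣+∣q∣ (outside ∷ p) (outside ∷ q) = ∣p∪q∣≤∣p∣+∣q∣ p q

injective⇒strictlySurjective : {f : Fin n → Fin n} → Injective _≡_ _≡_ f →
                               StrictlySurjective _≡_ f
injective⇒strictlySurjective {suc n} {f} f-injective y with Finₚ.any? (λ x → f x Fin.≟ y)
... | yes hit = hit
... | no miss = contradiction (Finₚ.injective⇒≤ f-avoiding-y-injective) 1+n≰n
  where
  f-avoiding-y : Fin (suc n) → Fin n
  f-avoiding-y x = punchOut (λ y≡fx → miss (x , sym y≡fx))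

  f-avoiding-y-injective : Injective _≡_ _≡_ f-avoiding-y
  f-avoiding-y-injective {x} {x′} eq = f-injective
    (Finₚ.punchOut-injective (λ y≡fx → miss (x , sym y≡fx)) (λ y≡fx′ → miss (x′ , sym y≡fx′)) eq)

injective⇒permutation : (f : Fin n → Fin n) → Injective _≡_ _≡_ f → Permutation′ n
injective⇒permutation f f-injective = permutation f (proj₁ ∘ surjective) (proj₂ ∘ surjective)
  (λ x → f-injective (proj₂ (surjective (f x))))
  where surjective = injective⇒strictlySurjective f-injective

Convex : (Fin n → ℕ) → Subset n → Set
Convex key T = ∀ {x y z} → x ∈ T → y ∈ T → key x ≤ key z → key z ≤ key y → z ∈ T

∣m-n∣<o : ∀ {m n o} → m < n + o → n < m + o → ∣ m - n ∣ < o
∣m-n∣<o {m} {n} {o} m<n+o n<m+o with ≤-total m n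
... | inj₁ m≤n = subst₂ _<_ (sym (m≤n⇒∣m-n∣≡n∸m m≤n)) (m+n∸m≡n m o) (∸-monoˡ-< n<m+o m≤n)
... | inj₂ n≤m = subst₂ _<_ (sym (m≤n⇒∣n-m∣≡n∸m n≤m)) (m+n∸m≡n n o) (∸-monoˡ-< m<n+o n≤m)

module Rank (key : Fin n → ℕ) (key-injective : Injective _≡_ _≡_ key) where

  below : Fin n → Subset n
  below x = select (λ z → key z <? key x)

  ∈-below⁺ : ∀ {x z} → key z < key x → z ∈ below x
  ∈-below⁺ {x} = ∈-select⁺ (λ z → key z <? key x)

  ∈-below⁻ : ∀ {x z} → z ∈ below x → key z < key x
  ∈-below⁻ {x} = ∈-select⁻ (λ z → key z <? key x)

  rank : Fin n → ℕ
  rank x = ∣ below x ∣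

  x∉below-x : ∀ x → x ∉ below x
  x∉below-x x x∈below-x = <-irrefl refl (∈-below⁻ x∈below-x)

  rank<n : ∀ x → rank x < n
  rank<n x = subst (rank x <_) (∣⊤∣≡n n) (p⊂q⇒∣p∣<∣q∣ (⊆⊤ , x , ∈⊤ , x∉below-x x))

  rank-mono-< : ∀ {x y} → key x < key y → rank x < rank y
  rank-mono-< {x} {y} kx<ky = p⊂q⇒∣p∣<∣q∣
    ( (λ z∈below-x → ∈-below⁺ (<-trans (∈-below⁻ z∈below-x) kx<ky))
    , x , ∈-below⁺ kx<ky , x∉below-x x)

  rank-injective : Injective _≡_ _≡_ rank
  rank-injective {x} {y} rx≡ry with <-cmp (key x) (key y)
  ... | tri< kx<ky _ _ = contradiction rx≡ry (<⇒≢ (rank-mono-< kx<ky))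
  ... | tri≈ _ kx≡ky _ = key-injective kx≡ky
  ... | tri> _ _ ky<kx = contradiction (sym rx≡ry) (<⇒≢ (rank-mono-< ky<kx))

  ranking : Permutation′ n
  ranking = injective⇒permutation (λ x → fromℕ< (rank<n x))
    (λ eq → rank-injective (Finₚ.fromℕ<-injective _ _ (rank<n _) (rank<n _) eq))

  rank<rank+∣T∣ : ∀ {T} → Convex key T → ∀ {x y} → x ∈ T → y ∈ T →
                  rank y < rank x + ∣ T ∣
  rank<rank+∣T∣ {T} T-convex {x} {y} x∈T y∈T with key x ≤? key y
  ... | no kx≰ky = ≤-trans (rank-mono-< (≰⇒> kx≰ky)) (m≤m+n (rank x) ∣ T ∣)
  ... | yes kx≤ky = ≤-trans (p⊂q⇒∣p∣<∣q∣ below-y⊂below-x∪T) (∣p∪q∣≤∣p∣+∣q∣ (below x) T)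
    where
    below-y⊆below-x∪T : ∀ {z} → z ∈ below y → z ∈ below x ∪ T
    below-y⊆below-x∪T {z} z∈below-y with key z <? key x
    ... | yes kz<kx = x∈p∪q⁺ (inj₁ (∈-below⁺ kz<kx))
    ... | no kz≮kx = x∈p∪q⁺ (inj₂ (T-convex x∈T y∈T (≮⇒≥ kz≮kx) (<⇒≤ (∈-below⁻ z∈below-y))))

    below-y⊂below-x∪T : below y ⊂ below x ∪ T
    below-y⊂below-x∪T = below-y⊆below-x∪T , y , x∈p∪q⁺ (inj₂ y∈T) , x∉below-x y

  ∣ranking-ranking∣<∣T∣ : ∀ {T} → Convex key T → ∀ {x y} → x ∈ T → y ∈ T →
                          ∣ toℕ (ranking ⟨$⟩ʳ x) - toℕ (ranking ⟨$⟩ʳ y) ∣ < ∣ T ∣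
  ∣ranking-ranking∣<∣T∣ T-convex {x} {y} x∈T y∈T
    rewrite Finₚ.toℕ-fromℕ< (rank<n x) | Finₚ.toℕ-fromℕ< (rank<n y) =
    ∣m-n∣<o (rank<rank+∣T∣ T-convex y∈T x∈T) (rank<rank+∣T∣ T-convex x∈T y∈T)

module Rotation {n} (l k : ℕ) (l+k≡n : l + k ≡ n) where

  rotate : ℕ → ℕ
  rotate a with a <? l
  ... | yes _ = a + k
  ... | no _  = a ∸ l

  b∸l<k : ∀ {b} → b < n → l ≤ b → b ∸ l < k
  b∸l<k {b} b<n l≤b =
    subst (b ∸ l <_) (m+n∸m≡n l k) (∸-monoˡ-< (subst (b <_) (sym l+k≡n) b<n) l≤b)

  rotate-< : ∀ {a} → a < n → rotate a < n
  rotate-< {a} a<n with a <? l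
  ... | yes a<l = subst (a + k <_) l+k≡n (+-monoˡ-< k a<l)
  ... | no _    = ≤-<-trans (m∸n≤m a l) a<n

  rotate-injective : ∀ {a b} → a < n → b < n → rotate a ≡ rotate b → a ≡ b
  rotate-injective {a} {b} a<n b<n eq with a <? l | b <? l
  ... | yes _   | yes _   = +-cancelʳ-≡ k a b eq
  ... | yes _   | no b≮l  =
    contradiction (subst (k ≤_) eq (m≤n+m k a)) (<⇒≱ (b∸l<k b<n (≮⇒≥ b≮l)))
  ... | no a≮l  | yes _   =
    contradiction (subst (k ≤_) (sym eq) (m≤n+m k b)) (<⇒≱ (b∸l<k a<n (≮⇒≥ a≮l)))
  ... | no a≮l  | no b≮l  = ∸-cancelʳ-≡ (≮⇒≥ a≮l) (≮⇒≥ b≮l) eq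

  k⊓l≤∣a-rotate-a∣ : ∀ a → k ⊓ l ≤ ∣ a - rotate a ∣
  k⊓l≤∣a-rotate-a∣ a with a <? l
  ... | yes _  = subst (k ⊓ l ≤_) (sym (∣m-m+n∣≡n a k)) (m⊓n≤m k l)
  ... | no a≮l = subst (k ⊓ l ≤_) (sym ∣a-[a∸l]∣≡l) (m⊓n≤n k l)
    where
    ∣a-[a∸l]∣≡l : ∣ a - (a ∸ l) ∣ ≡ l
    ∣a-[a∸l]∣≡l = trans (m≤n⇒∣n-m∣≡n∸m (m∸n≤m a l)) (m∸[m∸n]≡n (≮⇒≥ a≮l))

  rotation : Permutation′ n
  rotation = injective⇒permutation (λ a → fromℕ< (rotate-< (Finₚ.toℕ<n a)))
    (λ eq → Finₚ.toℕ-injective (rotate-injective (Finₚ.toℕ<n _) (Finₚ.toℕ<n _)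
      (Finₚ.fromℕ<-injective _ _ (rotate-< (Finₚ.toℕ<n _)) (rotate-< (Finₚ.toℕ<n _)) eq)))

  k⊓l≤∣a-rotation-a∣ : ∀ a → k ⊓ l ≤ ∣ toℕ a - toℕ (rotation ⟨$⟩ʳ a) ∣
  k⊓l≤∣a-rotation-a∣ a = subst (λ r → k ⊓ l ≤ ∣ toℕ a - r ∣)
    (sym (Finₚ.toℕ-fromℕ< (rotate-< (Finₚ.toℕ<n a)))) (k⊓l≤∣a-rotate-a∣ (toℕ a))

conjugate-mapsOutside : ∀ {s} (ρ σ : Permutation′ n) (T : Subset n) →
  (∀ {x y} → x ∈ T → y ∈ T → ∣ toℕ (ρ ⟨$⟩ʳ x) - toℕ (ρ ⟨$⟩ʳ y) ∣ < s) →
  (∀ a → s ≤ ∣ toℕ a - toℕ (σ ⟨$⟩ʳ a) ∣) →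
  MapsOutside (ρ ∘ₚ σ ∘ₚ flip ρ) T
conjugate-mapsOutside {s = s} ρ σ T diameter<s s≤displacement x x∈T πx∈T =
  <⇒≱ (diameter<s x∈T πx∈T)
    (subst (λ r → s ≤ ∣ toℕ (ρ ⟨$⟩ʳ x) - toℕ r ∣) (sym (inverseʳ ρ)) (s≤displacement (ρ ⟨$⟩ʳ x)))

combine-squeezeˡ : ∀ {k m} {i i′ : Fin m} {j j′ j″ : Fin k} →
  toℕ (combine i j) ≤ toℕ (combine i′ j′) → toℕ (combine i′ j′) ≤ toℕ (combine i j″) →
  i′ ≡ i
combine-squeezeˡ {i = i} {i′} {j} {j′} {j″} lower upper with Finₚ.<-cmp i′ i
... | tri< i′<i _ _ = contradiction lower (<⇒≱ (Finₚ.combine-monoˡ-< j′ j i′<i))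
... | tri≈ _ i′≡i _ = i′≡i
... | tri> _ _ i<i′ = contradiction upper (<⇒≱ (Finₚ.combine-monoˡ-< j″ j′ i<i′))

module Blocks {m} (S : Fin m → Subset n) (disjoint : PairwiseDisjoint S) where

  block : Fin n → Fin (suc m)
  block x with Finₚ.any? (λ i → x ∈? S i)
  ... | yes (i , _) = suc i
  ... | no _        = zero

  ∈-block : ∀ {x i} → block x ≡ suc i → x ∈ S i
  ∈-block {x} with Finₚ.any? (λ i → x ∈? S i)
  ... | yes (j , x∈Sj) = λ sj≡si → subst (λ j → x ∈ S j) (Finₚ.suc-injective sj≡si) x∈Sj
  ... | no _           = λ ()

  block-∈ : ∀ {x i} → x ∈ S i → block x ≡ suc i
  block-∈ {x} {i} x∈Si with Finₚ.any? (λ i → x ∈? S i)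
  ... | no x∉⋃S = contradiction (i , x∈Si) x∉⋃S
  ... | yes (j , x∈Sj) with j Fin.≟ i
  ...   | yes j≡i = cong suc j≡i
  ...   | no j≢i  = contradiction x∈Si (disjoint j i j≢i x x∈Sj)

  -- toℕ (combine b x) = n * b + x, so ordering by key sorts by block first: every S i is an interval.
  key : Fin n → ℕ
  key x = toℕ (combine (block x) x)

  key-injective : Injective _≡_ _≡_ key
  key-injective {x} {y} eq =
    Finₚ.combine-injectiveʳ (block x) x (block y) y (Finₚ.toℕ-injective eq)

  S-convex : ∀ i → Convex key (S i)
  S-convex i {x} {y} {z} x∈Si y∈Si kx≤kz kz≤ky = ∈-block (combine-squeezeˡ
    (subst (λ b → toℕ (combine b x) ≤ key z) (block-∈ x∈Si) kx≤kz)
    (subst (λ b → key z ≤ toℕ (combine b y)) (block-∈ y∈Si) kz≤ky))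

2*s≤n⇒s≤⌊n/2⌋ : ∀ {s n} → 2 * s ≤ n → s ≤ ⌊ n /2⌋
2*s≤n⇒s≤⌊n/2⌋ {s} {n} 2s≤n = subst (_≤ ⌊ n /2⌋) (sym (n≡⌊n+n/2⌋ s))
  (⌊n/2⌋-mono (subst (_≤ n) (cong (s +_) (+-identityʳ s)) 2s≤n))

module Inversion {m} (S : Fin m → Subset n) (disjoint : PairwiseDisjoint S) where

  open Blocks S disjoint
  open Rank key key-injective
  open Rotation ⌈ n /2⌉ ⌊ n /2⌋ (trans (+-comm ⌈ n /2⌉ _) (⌊n/2⌋+⌈n/2⌉≡n n))

  inversion : Permutation′ n
  inversion = ranking ∘ₚ rotation ∘ₚ flip ranking

  inversion-mapsOutside : ∀ i → 2 * ∣ S i ∣ ≤ n → MapsOutside inversion (S i)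
  inversion-mapsOutside i 2s≤n =
    conjugate-mapsOutside ranking rotation (S i) (∣ranking-ranking∣<∣T∣ (S-convex i)) s≤displacement
    where
    s≤⌊n/2⌋ : ∣ S i ∣ ≤ ⌊ n /2⌋
    s≤⌊n/2⌋ = 2*s≤n⇒s≤⌊n/2⌋ 2s≤n

    s≤displacement : ∀ a → ∣ S i ∣ ≤ ∣ toℕ a - toℕ (rotation ⟨$⟩ʳ a) ∣
    s≤displacement a =
      ≤-trans (⊓-glb s≤⌊n/2⌋ (≤-trans s≤⌊n/2⌋ (⌊n/2⌋≤⌈n/2⌉ n))) (k⊓l≤∣a-rotation-a∣ a)

corollary2p2 : (n m : ℕ) (S : Fin m → Subset n) → PairwiseDisjoint S →
    (Invertible S → ∀ i → 2 * ∣ S i ∣ ≤ n) × ((∀ i → 2 * ∣ S i ∣ ≤ n) → Invertible S)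
corollary2p2 n m S disjoint =
  (λ (π , π-inverts) i → mapsOutside⇒2*∣p∣≤n π (S i) (π-inverts i)) ,
  (λ small → inversion , λ i → inversion-mapsOutside i (small i))
  where open Inversion S disjoint
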